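{- Let $q$ be a prime and $D\ge1$. For any $S\in\mathrm{Sym}_D$ and $\mathcal{C}\in GL(D,q)$, $\rho((\mathcal{C},0))\,W(S)=W((\mathcal{C}^{ -1})^tS\mathcal{C}^{ -1})$.
   Context: Equip $\mathbb{F}_q^{2D}$ with the non-degenerate symplectic form $\mathfrak{B}$ for which $e_1,\dots,e_D,f_1,\dots,f_D$ is a symplectic basis: $\mathfrak{B}(e_i,e_j)=\mathfrak{B}(f_i,f_j)=0$, $\mathfrak{B}(e_i,f_j)=-\mathfrak{B}(f_j,e_i)=\delta_{ij}$. Let $X$ be the set of maximal isotropic subspaces of $\mathbb{F}_q^{2D}$ and $V=\mathrm{span}_{\mathbb{C}}\{|x\rangle:x\in X\}$ with $\{|x\rangle\}$ orthonormal. Put $x_i=\mathrm{span}\{e_1,\dots,e_{D-i}\}\oplus\mathrm{span}\{f_{D-i+1},\dots,f_D\}$ ($0\le i\le D$). $\mathrm{Sym}_D$ is the set of symmetric $D\times D$ matrices over $\mathbb{F}_q$, $\mathrm{Sym}_{D,i}$ those $\mathcal{F}$ with $\mathcal{F}_{mn}=0$ whenever $m\le D-i$ or $n\le D-i$. For $\mathcal{C}\in GL(D,q)$, $\mathcal{F}\in\mathrm{Sym}_D$, $(\mathcal{C},\mathcal{F})\in Sp(2D,q)$ has matrix $\begin{pmatrix}\mathcal{C}&0\\0&(\mathcal{C}^t)^{ -1}\end{pmatrix}\begin{pmatrix}I&\mathcal{F}\\0&I\end{pmatrix}$ in the basis $(e_1,\dots,e_D,f_1,\dots,f_D)$; $g$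 acts on $X$ by $gx=\{gv:v\in x\}$ and $\rho(g)|x\rangle=|gx\rangle$. For $S'\in\mathrm{Sym}_{D,i}$, $|[I],S'\rangle_i=q^{ -i(i+1)/4}\sum_{\mathcal{F}\in\mathrm{Sym}_{D,i}}e^{2\pi\sqrt{ -1}\,\mathrm{tr}(S'\mathcal{F})/q}|(I,\mathcal{F})x_i\rangle$ (elements of $\mathbb{F}_q$ in exponents identified with integers in $\{0,\dots,q-1\}$). For $S\in\mathrm{Sym}_D$ and $\mathcal{C}\in GL(D,q)$ with $\mathcal{C}^tS\mathcal{C}\in\mathrm{Sym}_{D,i}$, $|[\mathcal{C}],S\rangle_i=\rho((\mathcal{C},0))|[I],\mathcal{C}^tS\mathcal{C}\rangle_i$. $W_i(S)=\mathrm{span}_{\mathbb{C}}\{|[\mathcal{C}],S\rangle_i:\mathcal{C}\in GL(D,q),\ \mathcal{C}^tS\mathcal{C}\in\mathrm{Sym}_{D,i}\}$ and $W(S)=\bigoplus_{i=0}^DW_i(S)$. -}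

module Defs where

open import Level using (Level; _⊔_)
open import Data.Nat using (ℕ; zero; suc; _∸_; _<_; _≤_; NonZero; _<?_) renaming (_+_ to _+ℕ_; _*_ to _*ℕ_)
open import Data.Nat.DivMod using (_mod_)
open import Data.Fin using (Fin; toℕ)
open import Data.Fin.Properties using () renaming (_≟_ to _≟F_)
open import Data.Bool using (Bool; true; false; _∧_; if_then_else_; not)
open import Data.List using (List; []; _∷_; [_]; map; concatMap; filterᵇ; foldr; cartesianProduct; allFin)
open import Data.Bool.ListAction using (all; any)
open import Data.Vec.Functional using (Vector) renaming (_∷_ to _∷ᶠ_)
open import Data.Product using (Σ; ∃; _×_; _,_; proj₁; proj₂)
open import Data.Sum using (_⊎_)
open import Relation.Nullary using (¬_; does)
open import Relation.Binary.PropositionalEquality using (_≡_)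
open import Algebra.Bundles using (CommutativeRing)

-- Fields: a commutative ring with 1 ≠ 0 in which nonzero elements are
-- invertible (agda-stdlib has no Field bundle).

IsField : ∀ {c ℓ} → CommutativeRing c ℓ → Set (c ⊔ ℓ)
IsField K = ¬ (1# ≈ 0#) × (∀ x → ¬ (x ≈ 0#) → ∃ λ y → x * y ≈ 1#)
  where open CommutativeRing K

allFuns : ∀ {a} {A : Set a} (n : ℕ) → List A → List (Fin n → A)
allFuns zero    xs = [ (λ ()) ]
allFuns (suc n) xs = concatMap (λ a → map (λ f → a ∷ᶠ f) (allFuns n xs)) xs

module PrimeField (q : ℕ) .{{nz : NonZero q}} where

  𝔽 : Set
  𝔽 = Fin q

  0F 1F : 𝔽
  0F = 0 mod q
  1F = 1 mod q

  _+F_ _*F_ : 𝔽 → 𝔽 → 𝔽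
  a +F b = (toℕ a +ℕ toℕ b) mod q
  a *F b = (toℕ a *ℕ toℕ b) mod q

  _==F_ : 𝔽 → 𝔽 → Bool
  a ==F b = does (a ≟F b)

  allF : List 𝔽
  allF = allFin q

  sumF : ∀ {n} → (Fin n → 𝔽) → 𝔽
  sumF {zero}  f = 0F
  sumF {suc n} f = f Fin.zero +F sumF (λ k → f (Fin.suc k))

  module Dim (D : ℕ) where

    Mat : Set
    Mat = Fin D → Fin D → 𝔽

    Vec : Set
    Vec = Fin D → 𝔽

    I : Mat
    I m n = if does (m ≟F n) then 1F else 0F

    0M : Mat
    0M m n = 0F

    _ᵗ : Mat → Mat
    (A ᵗ) m n = A n m

    _·_ : Mat → Mat → Mat
    (A · B) m n = sumF (λ k → A m k *F B k n)

    _▷_ : Mat → Vec → Vec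
    (A ▷ v) m = sumF (λ k → A m k *F v k)

    _+V_ : Vec → Vec → Vec
    (u +V v) m = u m +F v m

    tr : Mat → 𝔽
    tr A = sumF (λ k → A k k)

    IsSym : Mat → Set
    IsSym S = ∀ m n → S m n ≡ S n m

    -- Sym_{D,i}: symmetric, F_{mn} = 0 whenever m ≤ D-i or n ≤ D-i
    -- (1-indexed m ≤ D-i  ⇔  0-indexed toℕ m < D ∸ i).
    InSym : ℕ → Mat → Set
    InSym i S = IsSym S × (∀ m n → (toℕ m < D ∸ i ⊎ toℕ n < D ∸ i) → S m n ≡ 0F)

    inSymᵇ : ℕ → Mat → Bool
    inSymᵇ i S = all (λ m → all (λ n →
                   (S m n ==F S n m) ∧
                   (if does (_<?_ (toℕ m) (D ∸ i)) then S m n ==F 0F else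
                    if does (_<?_ (toℕ n) (D ∸ i)) then S m n ==F 0F else true))
                   (allFin D)) (allFin D)

    allMat : List Mat
    allMat = allFuns D (allFuns D allF)

    SymList : ℕ → List Mat
    SymList i = filterᵇ (inSymᵇ i) allMat

    record GL : Set where
      field
        C    : Mat
        Cinv : Mat
        invʳ : ∀ m n → (C · Cinv) m n ≡ I m n
        invˡ : ∀ m n → (Cinv · C) m n ≡ I m n

    -- Vectors of F_q^{2D} in the basis (e_1..e_D, f_1..f_D):
    -- a pair (a , b) means Σ a_m e_m + Σ b_m f_m.
    V2 : Set
    V2 = Vec × Vec

    allV2 : List V2
    allV2 = cartesianProduct (allFuns D allF) (allFuns D allF)

    _==V2_ : V2 → V2 → Bool
    (a , b) ==V2 (a' , b') = all (λ m → (a m ==F a' m) ∧ (b m ==F b' m)) (allFin D)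

    -- The element (C,F) of Sp(2D,q), with matrix
    -- diag(C, (Cᵗ)⁻¹) · [[I,F],[0,I]]; (Cᵗ)⁻¹ = (C⁻¹)ᵗ.
    -- (C and its inverse Cinv are passed explicitly.)
    act : Mat → Mat → Mat → V2 → V2
    act C Cinv F (a , b) = (C ▷ (a +V (F ▷ b)) , (Cinv ᵗ) ▷ b)

    Sub : Set
    Sub = V2 → Bool

    image : (V2 → V2) → Sub → Sub
    image g x u = any (λ v → x v ∧ (g v ==V2 u)) allV2

    sameSub : Sub → Sub → Bool
    sameSub x y = all (λ u → (not (x u) ∧ not (y u)) ∨' (x u ∧ y u)) allV2
      where
        _∨'_ : Bool → Bool → Bool
        true  ∨' _ = true
        false ∨' b = b

    -- x_i = span{e_1..e_{D-i}} ⊕ span{f_{D-i+1}..f_D}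
    xsub : ℕ → Sub
    xsub i (a , b) = all (λ m →
      if does (_<?_ (toℕ m) (D ∸ i)) then b m ==F 0F else a m ==F 0F)
      (allFin D)

    -- The complex vector space V with orthonormal basis |x⟩, with the
    -- coefficient field ℂ replaced by an arbitrary field K containing a
    -- primitive q-th root of unity ζ (ζ = e^{2πi/q} for K = ℂ) and
    -- normalisation constants ν i (ν i = q^{-i(i+1)/4} for K = ℂ).
    -- Vectors are formal finite linear combinations Σ c |x⟩, compared
    -- coefficientwise.

    module Ket {c ℓ} (K : CommutativeRing c ℓ) (ζ : CommutativeRing.Carrier K)
               (ν : ℕ → CommutativeRing.Carrier K) where
      open CommutativeRing K

      _^K_ : Carrier → ℕ → Carrier
      x ^K zero  = 1#
      x ^K suc n = x * (x ^K n)

      ℕ→K : ℕ → Carrier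
      ℕ→K zero    = 0#
      ℕ→K (suc n) = 1# + ℕ→K n

      𝕍 : Set c
      𝕍 = List (Carrier × Sub)

      ket : Sub → 𝕍
      ket x = [ (1# , x) ]

      coeff : 𝕍 → Sub → Carrier
      coeff v y = foldr (λ p acc → (if sameSub (proj₂ p) y then proj₁ p else 0#) + acc) 0# v

      _≈V_ : 𝕍 → 𝕍 → Set ℓ
      v ≈V w = ∀ y → coeff v y ≈ coeff w y

      scale : Carrier → 𝕍 → 𝕍
      scale k v = map (λ p → (k * proj₁ p , proj₂ p)) v

      ρ : (V2 → V2) → 𝕍 → 𝕍
      ρ g v = map (λ p → (proj₁ p , image g (proj₂ p))) v

      ketI : (i : ℕ) → Mat → 𝕍
      ketI i S' = scale (ν i)
        (map (λ F → (ζ ^K toℕ (tr (S' · F)) , image (act I I F) (xsub i))) (SymList i))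

      record Gen (S : Mat) : Set where
        field
          i    : ℕ
          i≤D  : i ≤ D
          g    : GL
          cond : InSym i ((GL.C g ᵗ) · (S · GL.C g))

      genVec : (S : Mat) → Gen S → 𝕍
      genVec S γ = ρ (act (GL.C g) (GL.Cinv g) 0M) (ketI i ((GL.C g ᵗ) · (S · GL.C g)))
        where open Gen γ

      InW : Mat → 𝕍 → Set (c ⊔ ℓ)
      InW S v = Σ (List (Carrier × Gen S)) λ cs →
        v ≈V concatMap (λ p → scale (proj₁ p) (genVec S (proj₂ p))) cs

      InρW : GL → Mat → 𝕍 → Set (c ⊔ ℓ)
      InρW h S v = Σ 𝕍 λ w → InW S w × (v ≈V ρ (act (GL.C h) (GL.Cinv h) 0M) w)

-- Fix h ∈ GL(D,q) and put S' = (h⁻¹)ᵗ S h⁻¹. Left multiplication C ↦ hC sends a generator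
-- |[C],S⟩_i of W(S) to the generator |[hC],S'⟩_i of W(S'), because (hC)ᵗ S' (hC) = Cᵗ S C
-- and ρ((h,0)) ρ((C,0)) = ρ((hC,0)); left multiplication by h⁻¹ goes back. Since (h,0) is a
-- bijection of F_q^{2D}, the coefficient of |y⟩ in ρ((h,0)) v is the coefficient of
-- |(h,0)⁻¹ y⟩ in v, so ρ((h,0)) respects coefficientwise equality and carries the span of
-- the generators of W(S) onto the span of their images.

module Submission where

open import Defs
open import Level using (Level)
open import Function using (_∘_)
open import Function.Bundles using (mk⇔; Equivalence)
open import Data.Nat using (ℕ; zero; suc; _≤_; NonZero; _%_) renaming (_+_ to _+ℕ_; _*_ to _*ℕ_)
import Data.Nat.Properties as ℕ
open import Data.Nat.DivMod using (_mod_; %-distribˡ-+; %-distribˡ-*; m<n⇒m%n≡m)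
open import Data.Nat.Primality using (Prime)
open import Data.Fin using (Fin; toℕ; zero; suc)
open import Data.Fin.Properties using (toℕ-injective; toℕ<n; toℕ-fromℕ<; fromℕ<-cong) renaming (_≟_ to _≟F_)
open import Data.Bool using (Bool; true; false; T; if_then_else_)
open import Data.Bool.Properties using (T-∧; T?)
open import Data.Product using (_×_; _,_; proj₁; proj₂; ∃; map₂)
open import Data.Product.Relation.Binary.Pointwise.NonDependent using (_×ₛ_)
open import Data.List using (List; []; _∷_; map; concatMap; allFin)
open import Data.List.Properties using (map-cong; map-concatMap; concatMap-map)
open import Data.List.Membership.Propositional using (_∈_; find; lose)
open import Data.List.Membership.Propositional.Properties
  using (∈-map⁺; ∈-map⁻; ∈-concatMap⁺; ∈-concatMap⁻; ∈-allFin; ∈-cartesianProduct⁺; ∈-cartesianProduct⁻)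
import Data.List.Relation.Unary.All as All
open import Data.List.Relation.Unary.All.Properties using (all⁺; all⁻)
import Data.List.Relation.Unary.Any as Any
open import Data.List.Relation.Unary.Any.Properties using (any⁺; any⁻)
open import Data.List.Relation.Binary.Pointwise using (Pointwise; []; _∷_; ++⁺)
open import Data.Vec.Functional using () renaming (_∷_ to _∷ᶠ_)
open import Relation.Nullary using (¬_; does; yes; no)
open import Relation.Nullary.Decidable using (does-⇔)
open import Relation.Binary.Bundles using (Setoid)
open import Relation.Binary.PropositionalEquality
open import Relation.Binary.PropositionalEquality.Algebra using (isMagma)
import Relation.Binary.Reasoning.Setoid as SetoidReasoning
open import Algebra.Bundles using (CommutativeRing; CommutativeSemiring)
open import Algebra.Structures using (IsCommutativeSemiring)
open import Algebra.Structures.Biased using (isCommutativeSemiringˡ; isCommutativeMonoidˡ)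

T-injective : {a b : Bool} → (T a → T b) → (T b → T a) → a ≡ b
T-injective {a} {b} a⇒b b⇒a = does-⇔ (mk⇔ a⇒b b⇒a) (T? a) (T? b)

module Enumeration {A : Set} (xs : List A) where

  canonical : ∀ {n} → (Fin n → A) → (Fin n → A)
  canonical {zero}  f = λ ()
  canonical {suc n} f = f zero ∷ᶠ canonical (f ∘ suc)

  canonical-≗ : ∀ {n} (f : Fin n → A) → canonical f ≗ f
  canonical-≗ {suc n} f zero    = refl
  canonical-≗ {suc n} f (suc k) = canonical-≗ (f ∘ suc) k

  canonical-cong : ∀ {n} {f g : Fin n → A} → f ≗ g → canonical f ≡ canonical g
  canonical-cong {zero}  f≗g = refl
  canonical-cong {suc n} f≗g = cong₂ _∷ᶠ_ (f≗g zero) (canonical-cong (f≗g ∘ suc))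

  canonical-∈ : ∀ {n} (f : Fin n → A) → (∀ k → f k ∈ xs) → canonical f ∈ allFuns n xs
  canonical-∈ {zero}  f f∈ = Any.here refl
  canonical-∈ {suc n} f f∈ = ∈-concatMap⁺ _
    (Any.map (λ { refl → ∈-map⁺ (f zero ∷ᶠ_) (canonical-∈ (f ∘ suc) (f∈ ∘ suc)) }) (f∈ zero))

  ∈-allFuns⇒canonical : ∀ {n} {f : Fin n → A} → f ∈ allFuns n xs → canonical f ≡ f
  ∈-allFuns⇒canonical {zero}  (Any.here refl) = refl
  ∈-allFuns⇒canonical {suc n} f∈ with Any.satisfied (∈-concatMap⁻ _ {xs = xs} f∈)
  ... | a , f∈map with ∈-map⁻ (a ∷ᶠ_) f∈map
  ... | f' , f'∈ , refl = cong (a ∷ᶠ_) (∈-allFuns⇒canonical f'∈)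

  ∈-allFuns-unique : ∀ {n} {f g : Fin n → A} → f ∈ allFuns n xs → g ∈ allFuns n xs → f ≗ g → f ≡ g
  ∈-allFuns-unique f∈ g∈ f≗g =
    trans (sym (∈-allFuns⇒canonical f∈)) (trans (canonical-cong f≗g) (∈-allFuns⇒canonical g∈))

module 𝔽-Semiring (q : ℕ) .{{_ : NonZero q}} where
  open PrimeField q
  open ≡-Reasoning

  ι : ℕ → 𝔽
  ι n = n mod q

  toℕ-ι : ∀ n → toℕ (ι n) ≡ n % q
  toℕ-ι n = toℕ-fromℕ< _

  ι-toℕ : ∀ a → ι (toℕ a) ≡ a
  ι-toℕ a = toℕ-injective (trans (toℕ-ι (toℕ a)) (m<n⇒m%n≡m (toℕ<n a)))

  ι-+ : ∀ m n → ι (m +ℕ n) ≡ ι m +F ι n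
  ι-+ m n = fromℕ<-cong _ _ (trans (%-distribˡ-+ m n q)
    (sym (cong₂ (λ a b → (a +ℕ b) % q) (toℕ-ι m) (toℕ-ι n)))) _ _

  ι-* : ∀ m n → ι (m *ℕ n) ≡ ι m *F ι n
  ι-* m n = fromℕ<-cong _ _ (trans (%-distribˡ-* m n q)
    (sym (cong₂ (λ a b → (a *ℕ b) % q) (toℕ-ι m) (toℕ-ι n)))) _ _

  ι-ind : (P : 𝔽 → Set) → (∀ n → P (ι n)) → ∀ a → P a
  ι-ind P h a = subst P (ι-toℕ a) (h (toℕ a))

  ι-ind₃ : (P : 𝔽 → 𝔽 → 𝔽 → Set) → (∀ m n k → P (ι m) (ι n) (ι k)) → ∀ a b c → P a b c
  ι-ind₃ P h a b c =
    ι-ind (λ a → P a b c) (λ m → ι-ind (λ b → P _ b c) (λ n → ι-ind (P _ _) (h m n) c) b) a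

  +F-comm : ∀ a b → a +F b ≡ b +F a
  +F-comm a b = cong ι (ℕ.+-comm (toℕ a) (toℕ b))

  *F-comm : ∀ a b → a *F b ≡ b *F a
  *F-comm a b = cong ι (ℕ.*-comm (toℕ a) (toℕ b))

  +F-identityˡ : ∀ a → 0F +F a ≡ a
  +F-identityˡ = ι-ind (λ a → 0F +F a ≡ a) (λ n → sym (ι-+ 0 n))

  *F-identityˡ : ∀ a → 1F *F a ≡ a
  *F-identityˡ = ι-ind (λ a → 1F *F a ≡ a) λ n →
    trans (sym (ι-* 1 n)) (cong ι (ℕ.*-identityˡ n))

  *F-zeroˡ : ∀ a → 0F *F a ≡ 0F
  *F-zeroˡ = ι-ind (λ a → 0F *F a ≡ 0F) (λ n → sym (ι-* 0 n))

  +F-assoc : ∀ a b c → (a +F b) +F c ≡ a +F (b +F c)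
  +F-assoc = ι-ind₃ (λ a b c → (a +F b) +F c ≡ a +F (b +F c)) λ m n k → begin
    (ι m +F ι n) +F ι k  ≡⟨ cong (_+F ι k) (ι-+ m n) ⟨
    ι (m +ℕ n) +F ι k    ≡⟨ ι-+ (m +ℕ n) k ⟨
    ι ((m +ℕ n) +ℕ k)    ≡⟨ cong ι (ℕ.+-assoc m n k) ⟩
    ι (m +ℕ (n +ℕ k))    ≡⟨ ι-+ m (n +ℕ k) ⟩
    ι m +F ι (n +ℕ k)    ≡⟨ cong (ι m +F_) (ι-+ n k) ⟩
    ι m +F (ι n +F ι k)  ∎

  *F-assoc : ∀ a b c → (a *F b) *F c ≡ a *F (b *F c)
  *F-assoc = ι-ind₃ (λ a b c → (a *F b) *F c ≡ a *F (b *F c)) λ m n k → begin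
    (ι m *F ι n) *F ι k  ≡⟨ cong (_*F ι k) (ι-* m n) ⟨
    ι (m *ℕ n) *F ι k    ≡⟨ ι-* (m *ℕ n) k ⟨
    ι ((m *ℕ n) *ℕ k)    ≡⟨ cong ι (ℕ.*-assoc m n k) ⟩
    ι (m *ℕ (n *ℕ k))    ≡⟨ ι-* m (n *ℕ k) ⟩
    ι m *F ι (n *ℕ k)    ≡⟨ cong (ι m *F_) (ι-* n k) ⟩
    ι m *F (ι n *F ι k)  ∎

  *F-distribʳ-+F : ∀ a b c → (b +F c) *F a ≡ (b *F a) +F (c *F a)
  *F-distribʳ-+F = ι-ind₃ (λ a b c → (b +F c) *F a ≡ (b *F a) +F (c *F a)) λ m n k → begin
    (ι n +F ι k) *F ι m           ≡⟨ cong (_*F ι m) (ι-+ n k) ⟨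
    ι (n +ℕ k) *F ι m             ≡⟨ ι-* (n +ℕ k) m ⟨
    ι ((n +ℕ k) *ℕ m)             ≡⟨ cong ι (ℕ.*-distribʳ-+ m n k) ⟩
    ι (n *ℕ m +ℕ k *ℕ m)          ≡⟨ ι-+ (n *ℕ m) (k *ℕ m) ⟩
    ι (n *ℕ m) +F ι (k *ℕ m)      ≡⟨ cong₂ _+F_ (ι-* n m) (ι-* k m) ⟩
    (ι n *F ι m) +F (ι k *F ι m)  ∎

  𝔽-isCommutativeSemiring : IsCommutativeSemiring _≡_ _+F_ _*F_ 0F 1F
  𝔽-isCommutativeSemiring = isCommutativeSemiringˡ record
    { +-isCommutativeMonoid = isCommutativeMonoidˡ record
      { isSemigroup = record { isMagma = isMagma _+F_ ; assoc = +F-assoc }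
      ; identityˡ   = +F-identityˡ
      ; comm        = +F-comm
      }
    ; *-isCommutativeMonoid = isCommutativeMonoidˡ record
      { isSemigroup = record { isMagma = isMagma _*F_ ; assoc = *F-assoc }
      ; identityˡ   = *F-identityˡ
      ; comm        = *F-comm
      }
    ; distribʳ = *F-distribʳ-+F
    ; zeroˡ    = *F-zeroˡ
    }

  𝔽-commutativeSemiring : CommutativeSemiring _ _
  𝔽-commutativeSemiring = record { isCommutativeSemiring = 𝔽-isCommutativeSemiring }

module Matrices (q : ℕ) .{{_ : NonZero q}} where
  open PrimeField q
  open 𝔽-Semiring q
  open CommutativeSemiring 𝔽-commutativeSemiring
    using (+-identityˡ; +-identityʳ; *-identityʳ; zeroˡ; zeroʳ; *-comm; *-assoc; distribˡ; distribʳ; +-commutativeSemigroup)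
  open import Algebra.Properties.CommutativeSemigroup +-commutativeSemigroup using (interchange)

  private variable
    m n p r : ℕ

  sumF-cong : {f g : Fin n → 𝔽} → (∀ k → f k ≡ g k) → sumF f ≡ sumF g
  sumF-cong {zero}  f≗g = refl
  sumF-cong {suc n} f≗g = cong₂ _+F_ (f≗g zero) (sumF-cong (f≗g ∘ suc))

  sumF-zero : sumF {n} (λ _ → 0F) ≡ 0F
  sumF-zero {zero}  = refl
  sumF-zero {suc n} = trans (cong (0F +F_) (sumF-zero {n})) (+-identityˡ 0F)

  sumF-+F : (f g : Fin n → 𝔽) → sumF (λ k → f k +F g k) ≡ sumF f +F sumF g
  sumF-+F {zero}  f g = sym (+-identityˡ 0F)
  sumF-+F {suc n} f g = trans (cong ((f zero +F g zero) +F_) (sumF-+F (f ∘ suc) (g ∘ suc)))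
                              (interchange (f zero) (g zero) _ _)

  *F-distribˡ-sumF : ∀ c (f : Fin n → 𝔽) → c *F sumF f ≡ sumF (λ k → c *F f k)
  *F-distribˡ-sumF {zero}  c f = zeroʳ c
  *F-distribˡ-sumF {suc n} c f =
    trans (distribˡ c (f zero) _) (cong ((c *F f zero) +F_) (*F-distribˡ-sumF c (f ∘ suc)))

  *F-distribʳ-sumF : ∀ c (f : Fin n → 𝔽) → sumF f *F c ≡ sumF (λ k → f k *F c)
  *F-distribʳ-sumF {zero}  c f = zeroˡ c
  *F-distribʳ-sumF {suc n} c f =
    trans (distribʳ c (f zero) _) (cong ((f zero *F c) +F_) (*F-distribʳ-sumF c (f ∘ suc)))

  sumF-comm : (f : Fin m → Fin n → 𝔽) → sumF (λ i → sumF (f i)) ≡ sumF (λ j → sumF (λ i → f i j))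
  sumF-comm {zero} {n} f = sym (sumF-zero {n})
  sumF-comm {suc m} f = trans (cong (sumF (f zero) +F_) (sumF-comm (f ∘ suc)))
                              (sym (sumF-+F (f zero) _))

  Matrix : ℕ → ℕ → Set
  Matrix m n = Fin m → Fin n → 𝔽

  1ᴹ : Matrix n n
  1ᴹ i j = if does (i ≟F j) then 1F else 0F

  infix 8 _ᵀ
  _ᵀ : Matrix m n → Matrix n m
  (A ᵀ) i j = A j i

  infixl 7 _*ᴹ_
  _*ᴹ_ : Matrix m n → Matrix n p → Matrix m p
  (A *ᴹ B) i j = sumF (λ k → A i k *F B k j)

  sumF-1ᴹ : (f : Fin n → 𝔽) (j : Fin n) → sumF (λ k → f k *F 1ᴹ k j) ≡ f j
  sumF-1ᴹ {suc n} f zero = begin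
    (f zero *F 1F) +F sumF (λ k → f (suc k) *F 0F)  ≡⟨ cong₂ _+F_ (*-identityʳ (f zero)) sum-zeros ⟩
    f zero +F 0F                                    ≡⟨ +-identityʳ (f zero) ⟩
    f zero                                          ∎
    where
    open ≡-Reasoning
    sum-zeros : sumF (λ k → f (suc k) *F 0F) ≡ 0F
    sum-zeros = trans (sumF-cong (λ k → zeroʳ (f (suc k)))) (sumF-zero {n})
  sumF-1ᴹ {suc n} f (suc j) = begin
    (f zero *F 0F) +F sumF (λ k → f (suc k) *F 1ᴹ k j)  ≡⟨ cong (_+F sumF (λ k → f (suc k) *F 1ᴹ k j)) (zeroʳ (f zero)) ⟩
    0F +F sumF (λ k → f (suc k) *F 1ᴹ k j)              ≡⟨ +-identityˡ _ ⟩
    sumF (λ k → f (suc k) *F 1ᴹ k j)                    ≡⟨ sumF-1ᴹ (f ∘ suc) j ⟩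
    f (suc j)                                           ∎
    where open ≡-Reasoning

  1ᴹ-symmetric : ∀ (i j : Fin n) → 1ᴹ i j ≡ 1ᴹ j i
  1ᴹ-symmetric zero    zero    = refl
  1ᴹ-symmetric zero    (suc j) = refl
  1ᴹ-symmetric (suc i) zero    = refl
  1ᴹ-symmetric (suc i) (suc j) = 1ᴹ-symmetric i j

  infix 4 _≐_
  _≐_ : Matrix m n → Matrix m n → Set
  A ≐ B = ∀ i j → A i j ≡ B i j

  Matrix-setoid : ℕ → ℕ → Setoid _ _
  Matrix-setoid m n = record
    { Carrier       = Matrix m n
    ; _≈_           = _≐_
    ; isEquivalence = record
      { refl  = λ i j → refl
      ; sym   = λ A≐B i j → sym (A≐B i j)
      ; trans = λ A≐B B≐C i j → trans (A≐B i j) (B≐C i j)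
      }
    }

  module ≐-Reasoning {m n : ℕ} = SetoidReasoning (Matrix-setoid m n)

  ≐-sym : {A B : Matrix m n} → A ≐ B → B ≐ A
  ≐-sym = Setoid.sym (Matrix-setoid _ _)

  ᵀ-cong : {A B : Matrix m n} → A ≐ B → A ᵀ ≐ B ᵀ
  ᵀ-cong A≐B i j = A≐B j i

  1ᴹ-ᵀ : 1ᴹ ᵀ ≐ 1ᴹ {n}
  1ᴹ-ᵀ i j = 1ᴹ-symmetric j i

  *ᴹ-congˡ : (A : Matrix m n) {B B' : Matrix n p} → B ≐ B' → A *ᴹ B ≐ A *ᴹ B'
  *ᴹ-congˡ A B≐B' i j = sumF-cong (λ k → cong (A i k *F_) (B≐B' k j))

  *ᴹ-congʳ : {A A' : Matrix m n} → A ≐ A' → (B : Matrix n p) → A *ᴹ B ≐ A' *ᴹ B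
  *ᴹ-congʳ A≐A' B i j = sumF-cong (λ k → cong (_*F B k j) (A≐A' i k))

  *ᴹ-assoc : (A : Matrix m n) (B : Matrix n p) (C : Matrix p r) → (A *ᴹ B) *ᴹ C ≐ A *ᴹ (B *ᴹ C)
  *ᴹ-assoc {n = n} {p = p} A B C i j = begin
    sumF (λ l → sumF (λ k → A i k *F B k l) *F C l j)
      ≡⟨ sumF-cong {p} (λ l → *F-distribʳ-sumF (C l j) (λ k → A i k *F B k l)) ⟩
    sumF (λ l → sumF (λ k → (A i k *F B k l) *F C l j))
      ≡⟨ sumF-comm (λ l k → (A i k *F B k l) *F C l j) ⟩
    sumF (λ k → sumF (λ l → (A i k *F B k l) *F C l j))
      ≡⟨ sumF-cong {n} (λ k → sumF-cong {p} (λ l → *-assoc (A i k) (B k l) (C l j))) ⟩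
    sumF (λ k → sumF (λ l → A i k *F (B k l *F C l j)))
      ≡⟨ sumF-cong {n} (λ k → *F-distribˡ-sumF (A i k) (λ l → B k l *F C l j)) ⟨
    sumF (λ k → A i k *F sumF (λ l → B k l *F C l j))
      ∎
    where open ≡-Reasoning

  *ᴹ-identityʳ : (A : Matrix m n) → A *ᴹ 1ᴹ ≐ A
  *ᴹ-identityʳ A i j = sumF-1ᴹ (A i) j

  *ᴹ-identityˡ : (A : Matrix m n) → 1ᴹ *ᴹ A ≐ A
  *ᴹ-identityˡ A i j = trans (sumF-cong (λ k → trans (*-comm (1ᴹ i k) (A k j)) (cong (A k j *F_) (1ᴹ-symmetric i k))))
                             (sumF-1ᴹ (λ k → A k j) i)

  ᵀ-*ᴹ : (A : Matrix m n) (B : Matrix n p) → (A *ᴹ B) ᵀ ≐ B ᵀ *ᴹ A ᵀ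
  ᵀ-*ᴹ A B i j = sumF-cong (λ k → *-comm (A j k) (B k i))

  *ᴹ-cancelˡ : {A A' : Matrix n n} → A *ᴹ A' ≐ 1ᴹ → (B : Matrix n m) → A *ᴹ (A' *ᴹ B) ≐ B
  *ᴹ-cancelˡ {A = A} {A'} AA'≐1 B = begin
    A *ᴹ (A' *ᴹ B)  ≈⟨ ≐-sym (*ᴹ-assoc A A' B) ⟩
    A *ᴹ A' *ᴹ B    ≈⟨ *ᴹ-congʳ AA'≐1 B ⟩
    1ᴹ *ᴹ B         ≈⟨ *ᴹ-identityˡ B ⟩
    B               ∎
    where open ≐-Reasoning

  *ᴹ-cancelʳ : {A A' : Matrix n n} → A *ᴹ A' ≐ 1ᴹ → (B : Matrix m n) → B *ᴹ A *ᴹ A' ≐ B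
  *ᴹ-cancelʳ {A = A} {A'} AA'≐1 B = begin
    B *ᴹ A *ᴹ A'    ≈⟨ *ᴹ-assoc B A A' ⟩
    B *ᴹ (A *ᴹ A')  ≈⟨ *ᴹ-congˡ B AA'≐1 ⟩
    B *ᴹ 1ᴹ         ≈⟨ *ᴹ-identityʳ B ⟩
    B               ∎
    where open ≐-Reasoning

  *ᴹ-inverse : {A A' B B' : Matrix n n} → A *ᴹ A' ≐ 1ᴹ → B *ᴹ B' ≐ 1ᴹ → (A *ᴹ B) *ᴹ (B' *ᴹ A') ≐ 1ᴹ
  *ᴹ-inverse {A = A} {A'} {B} {B'} AA'≐1 BB'≐1 = begin
    (A *ᴹ B) *ᴹ (B' *ᴹ A')  ≈⟨ *ᴹ-assoc A B (B' *ᴹ A') ⟩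
    A *ᴹ (B *ᴹ (B' *ᴹ A'))  ≈⟨ *ᴹ-congˡ A (*ᴹ-cancelˡ {A = B} {B'} BB'≐1 A') ⟩
    A *ᴹ A'                 ≈⟨ AA'≐1 ⟩
    1ᴹ                      ∎
    where open ≐-Reasoning

module GeneralLinear (q : ℕ) .{{_ : NonZero q}} (D : ℕ) where
  open PrimeField q
  open Dim D
  open Matrices q
  open CommutativeSemiring (𝔽-Semiring.𝔽-commutativeSemiring q) using (+-identityʳ; zeroˡ)

  congr : Mat → Mat → Mat
  congr C S = C ᵀ *ᴹ (S *ᴹ C)

  congr-congʳ : (C : Mat) {M M' : Mat} → M ≐ M' → congr C M ≐ congr C M'
  congr-congʳ C M≐M' = *ᴹ-congˡ (C ᵀ) (*ᴹ-congʳ M≐M' C)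

  congr-*ᴹ : (A B M : Mat) → congr (A *ᴹ B) M ≐ congr B (congr A M)
  congr-*ᴹ A B M = begin
    (A *ᴹ B) ᵀ *ᴹ (M *ᴹ (A *ᴹ B))     ≈⟨ *ᴹ-congʳ (ᵀ-*ᴹ A B) (M *ᴹ (A *ᴹ B)) ⟩
    B ᵀ *ᴹ A ᵀ *ᴹ (M *ᴹ (A *ᴹ B))     ≈⟨ *ᴹ-assoc (B ᵀ) (A ᵀ) (M *ᴹ (A *ᴹ B)) ⟩
    B ᵀ *ᴹ (A ᵀ *ᴹ (M *ᴹ (A *ᴹ B)))   ≈⟨ *ᴹ-congˡ (B ᵀ) (*ᴹ-congˡ (A ᵀ) (≐-sym (*ᴹ-assoc M A B))) ⟩
    B ᵀ *ᴹ (A ᵀ *ᴹ (M *ᴹ A *ᴹ B))     ≈⟨ *ᴹ-congˡ (B ᵀ) (≐-sym (*ᴹ-assoc (A ᵀ) (M *ᴹ A) B)) ⟩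
    B ᵀ *ᴹ (A ᵀ *ᴹ (M *ᴹ A) *ᴹ B)     ∎
    where open ≐-Reasoning

  congr-cancel : {C C' : Mat} → C' *ᴹ C ≐ 1ᴹ → (S : Mat) → congr C (congr C' S) ≐ S
  congr-cancel {C} {C'} C'C≐1 S = begin
    congr C (congr C' S)            ≈⟨ ≐-sym (congr-*ᴹ C' C S) ⟩
    (C' *ᴹ C) ᵀ *ᴹ (S *ᴹ (C' *ᴹ C))  ≈⟨ *ᴹ-congʳ (ᵀ-cong C'C≐1) (S *ᴹ (C' *ᴹ C)) ⟩
    1ᴹ ᵀ *ᴹ (S *ᴹ (C' *ᴹ C))        ≈⟨ *ᴹ-congˡ (1ᴹ ᵀ) (*ᴹ-congˡ S C'C≐1) ⟩
    1ᴹ ᵀ *ᴹ (S *ᴹ 1ᴹ)               ≈⟨ *ᴹ-congʳ 1ᴹ-ᵀ (S *ᴹ 1ᴹ) ⟩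
    1ᴹ *ᴹ (S *ᴹ 1ᴹ)                 ≈⟨ *ᴹ-identityˡ (S *ᴹ 1ᴹ) ⟩
    S *ᴹ 1ᴹ                         ≈⟨ *ᴹ-identityʳ S ⟩
    S                               ∎
    where open ≐-Reasoning

  infixl 7 _·ᴳ_
  _·ᴳ_ : GL → GL → GL
  g ·ᴳ h = record
    { C    = GL.C g *ᴹ GL.C h
    ; Cinv = GL.Cinv h *ᴹ GL.Cinv g
    ; invʳ = *ᴹ-inverse {A = GL.C g} {GL.Cinv g} {GL.C h} {GL.Cinv h} (GL.invʳ g) (GL.invʳ h)
    ; invˡ = *ᴹ-inverse {A = GL.Cinv h} {GL.C h} {GL.Cinv g} {GL.C g} (GL.invˡ h) (GL.invˡ g)
    }

  infix 8 _⁻¹ᴳ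
  _⁻¹ᴳ : GL → GL
  g ⁻¹ᴳ = record { C = GL.Cinv g ; Cinv = GL.C g ; invʳ = GL.invˡ g ; invˡ = GL.invʳ g }

  V2-setoid : Setoid _ _
  V2-setoid = (Fin D →-setoid 𝔽) ×ₛ (Fin D →-setoid 𝔽)

  open Setoid V2-setoid public using () renaming (_≈_ to _≗₂_; refl to ≗₂-refl; sym to ≗₂-sym; trans to ≗₂-trans)

  Resp : (V2 → V2) → Set
  Resp g = ∀ {u w} → u ≗₂ w → g u ≗₂ g w

  ▷-congˡ : {A A' : Mat} → A ≐ A' → (v : Vec) → A ▷ v ≗ A' ▷ v
  ▷-congˡ A≐A' v i = sumF-cong (λ k → cong (_*F v k) (A≐A' i k))

  ▷-congʳ : (A : Mat) {v v' : Vec} → v ≗ v' → A ▷ v ≗ A ▷ v'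
  ▷-congʳ A v≗v' i = sumF-cong (λ k → cong (A i k *F_) (v≗v' k))

  column : Vec → Matrix D 1
  column v k _ = v k

  ▷-*ᴹ : (A B : Mat) (v : Vec) → A ▷ (B ▷ v) ≗ (A *ᴹ B) ▷ v
  ▷-*ᴹ A B v i = sym (*ᴹ-assoc A B (column v) i zero)

  ▷-identity : (v : Vec) → 1ᴹ ▷ v ≗ v
  ▷-identity v i = *ᴹ-identityˡ (column v) i zero

  0M-▷ : (v : Vec) → 0M ▷ v ≗ λ _ → 0F
  0M-▷ v i = trans (sumF-cong (λ k → zeroˡ (v k))) (sumF-zero {D})

  diagonal : Mat → Mat → V2 → V2
  diagonal C C' (a , b) = (C ▷ a , (C' ᵀ) ▷ b)

  diagonal-resp : (C C' : Mat) {u w : V2} → u ≗₂ w → diagonal C C' u ≗₂ diagonal C C' w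
  diagonal-resp C C' (a≗a' , b≗b') = ▷-congʳ C a≗a' , ▷-congʳ (C' ᵀ) b≗b'

  diagonal-cong : {C C' E E' : Mat} → C ≐ E → C' ≐ E' → (u : V2) → diagonal C C' u ≗₂ diagonal E E' u
  diagonal-cong C≐E C'≐E' (a , b) = ▷-congˡ C≐E a , ▷-congˡ (ᵀ-cong C'≐E') b

  diagonal-*ᴹ : (A A' B B' : Mat) (u : V2) →
                diagonal A A' (diagonal B B' u) ≗₂ diagonal (A *ᴹ B) (B' *ᴹ A') u
  diagonal-*ᴹ A A' B B' (a , b) =
    ▷-*ᴹ A B a , λ i → trans (▷-*ᴹ (A' ᵀ) (B' ᵀ) b i) (▷-congˡ (≐-sym (ᵀ-*ᴹ B' A')) b i)

  diagonal-identity : (u : V2) → diagonal 1ᴹ 1ᴹ u ≗₂ u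
  diagonal-identity (a , b) = ▷-identity a , λ i → trans (▷-congˡ 1ᴹ-ᵀ b i) (▷-identity b i)

  toSp : GL → V2 → V2
  toSp g = act (GL.C g) (GL.Cinv g) 0M

  toSp-diagonal : (g : GL) (u : V2) → toSp g u ≗₂ diagonal (GL.C g) (GL.Cinv g) u
  toSp-diagonal g (a , b) =
    ▷-congʳ (GL.C g) (λ k → trans (cong (a k +F_) (0M-▷ b k)) (+-identityʳ (a k))) , λ _ → refl

  toSp-resp : (g : GL) → Resp (toSp g)
  toSp-resp g {u} {w} u≗w = begin
    toSp g u                              ≈⟨ toSp-diagonal g u ⟩
    diagonal (GL.C g) (GL.Cinv g) u       ≈⟨ diagonal-resp (GL.C g) (GL.Cinv g) u≗w ⟩
    diagonal (GL.C g) (GL.Cinv g) w       ≈⟨ toSp-diagonal g w ⟨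
    toSp g w                              ∎
    where open SetoidReasoning V2-setoid

  toSp-cong : {g h : GL} → GL.C g ≐ GL.C h → GL.Cinv g ≐ GL.Cinv h → (u : V2) → toSp g u ≗₂ toSp h u
  toSp-cong {g} {h} C≐ Cinv≐ u = begin
    toSp g u                              ≈⟨ toSp-diagonal g u ⟩
    diagonal (GL.C g) (GL.Cinv g) u       ≈⟨ diagonal-cong C≐ Cinv≐ u ⟩
    diagonal (GL.C h) (GL.Cinv h) u       ≈⟨ toSp-diagonal h u ⟨
    toSp h u                              ∎
    where open SetoidReasoning V2-setoid

  toSp-·ᴳ : (g h : GL) (u : V2) → toSp g (toSp h u) ≗₂ toSp (g ·ᴳ h) u
  toSp-·ᴳ g h u = begin
    toSp g (toSp h u)                     ≈⟨ toSp-diagonal g (toSp h u) ⟩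
    diagonal Cg Cg' (toSp h u)            ≈⟨ diagonal-resp Cg Cg' (toSp-diagonal h u) ⟩
    diagonal Cg Cg' (diagonal Ch Ch' u)   ≈⟨ diagonal-*ᴹ Cg Cg' Ch Ch' u ⟩
    diagonal (Cg *ᴹ Ch) (Ch' *ᴹ Cg') u    ≈⟨ toSp-diagonal (g ·ᴳ h) u ⟨
    toSp (g ·ᴳ h) u                       ∎
    where
    open SetoidReasoning V2-setoid
    Cg = GL.C g ; Cg' = GL.Cinv g ; Ch = GL.C h ; Ch' = GL.Cinv h

  toSp-inverse : (g : GL) (u : V2) → toSp g (toSp (g ⁻¹ᴳ) u) ≗₂ u
  toSp-inverse g u = begin
    toSp g (toSp (g ⁻¹ᴳ) u)               ≈⟨ toSp-·ᴳ g (g ⁻¹ᴳ) u ⟩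
    toSp (g ·ᴳ g ⁻¹ᴳ) u                   ≈⟨ toSp-diagonal (g ·ᴳ g ⁻¹ᴳ) u ⟩
    diagonal (GL.C g *ᴹ GL.Cinv g) (GL.C g *ᴹ GL.Cinv g) u  ≈⟨ diagonal-cong (GL.invʳ g) (GL.invʳ g) u ⟩
    diagonal 1ᴹ 1ᴹ u                      ≈⟨ diagonal-identity u ⟩
    u                                     ∎
    where open SetoidReasoning V2-setoid

  toSp-cancelˡ : (h g : GL) (u : V2) → toSp h (toSp (h ⁻¹ᴳ ·ᴳ g) u) ≗₂ toSp g u
  toSp-cancelˡ h g u = ≗₂-trans (toSp-·ᴳ h (h ⁻¹ᴳ ·ᴳ g) u)
    (toSp-cong {h ·ᴳ (h ⁻¹ᴳ ·ᴳ g)} {g} (*ᴹ-cancelˡ {A = GL.C h} {GL.Cinv h} (GL.invʳ h) (GL.C g))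
                                     (*ᴹ-cancelʳ {A = GL.C h} {GL.Cinv h} (GL.invʳ h) (GL.Cinv g)) u)

module Subsets (q : ℕ) .{{_ : NonZero q}} (D : ℕ) where
  open PrimeField q
  open Dim D
  open GeneralLinear q D using (_≗₂_; ≗₂-refl; ≗₂-sym; ≗₂-trans; Resp)
  open Enumeration allF

  canonical₂ : V2 → V2
  canonical₂ (a , b) = canonical a , canonical b

  canonical₂-≗ : (u : V2) → canonical₂ u ≗₂ u
  canonical₂-≗ (a , b) = canonical-≗ a , canonical-≗ b

  canonical₂-∈ : (u : V2) → canonical₂ u ∈ allV2
  canonical₂-∈ (a , b) = ∈-cartesianProduct⁺ (canonical-∈ a (∈-allFin ∘ a)) (canonical-∈ b (∈-allFin ∘ b))

  ∈-allV2-unique : {u w : V2} → u ∈ allV2 → w ∈ allV2 → u ≗₂ w → u ≡ w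
  ∈-allV2-unique u∈ w∈ (a≗a' , b≗b') with ∈-cartesianProduct⁻ _ _ u∈ | ∈-cartesianProduct⁻ _ _ w∈
  ... | a∈ , b∈ | a'∈ , b'∈ = cong₂ _,_ (∈-allFuns-unique a∈ a'∈ a≗a') (∈-allFuns-unique b∈ b'∈ b≗b')

  ==F-sound : ∀ a b → T (a ==F b) → a ≡ b
  ==F-sound a b with a ≟F b
  ... | yes a≡b = λ _ → a≡b
  ... | no  _   = λ ()

  ==F-complete : ∀ a b → a ≡ b → T (a ==F b)
  ==F-complete a b with a ≟F b
  ... | yes _   = _
  ... | no  a≢b = a≢b

  ==V2-sound : ∀ u w → T (u ==V2 w) → u ≗₂ w
  ==V2-sound (a , b) (a' , b') t =
    (λ m → ==F-sound _ _ (proj₁ (agree m))) , (λ m → ==F-sound _ _ (proj₂ (agree m)))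
    where agree = λ m → Equivalence.to T-∧ (All.lookup (all⁺ _ (allFin D) t) (∈-allFin m))

  ==V2-complete : ∀ u w → u ≗₂ w → T (u ==V2 w)
  ==V2-complete (a , b) (a' , b') (a≗a' , b≗b') =
    all⁻ _ {xs = allFin D} (All.tabulate λ {m} _ →
      Equivalence.from T-∧ (==F-complete _ _ (a≗a' m) , ==F-complete _ _ (b≗b' m)))

  -- sameSub, and hence coeff, only inspects a subset at the listed points allV2.
  infix 4 _≈ˢ_
  _≈ˢ_ : Sub → Sub → Set
  x ≈ˢ y = ∀ {u} → u ∈ allV2 → x u ≡ y u

  ≈ˢ-sym : {x y : Sub} → x ≈ˢ y → y ≈ˢ x
  ≈ˢ-sym x≈y u∈ = sym (x≈y u∈)

  ≈ˢ-trans : {x y z : Sub} → x ≈ˢ y → y ≈ˢ z → x ≈ˢ z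
  ≈ˢ-trans x≈y y≈z u∈ = trans (x≈y u∈) (y≈z u∈)

  sameSub-sound : {x y : Sub} → T (sameSub x y) → x ≈ˢ y
  sameSub-sound {x} {y} t {u} u∈ with x u | y u | All.lookup (all⁺ _ allV2 t) u∈
  ... | true  | true  | _ = refl
  ... | false | false | _ = refl

  sameSub-const : ∀ b → T (sameSub (λ _ → b) (λ _ → b))
  sameSub-const true  = all⁻ _ (All.universal _ allV2)
  sameSub-const false = all⁻ _ (All.universal _ allV2)

  -- The pointwise test inside sameSub is local to its definition; it is
  -- reached by evaluating sameSub on constant subsets.
  sameSub-complete : {x y : Sub} → x ≈ˢ y → T (sameSub x y)
  sameSub-complete {x} {y} x≈y = all⁻ _ (All.tabulate λ {u} u∈ →
    let x≈y-at-u = subst (λ c → T (sameSub (λ _ → x u) (λ _ → c))) (x≈y u∈) (sameSub-const (x u))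
    in All.lookup (all⁺ _ allV2 x≈y-at-u) u∈)

  image-intro : {g : V2 → V2} {x : Sub} {u : V2} (v : V2) → v ∈ allV2 → T (x v) → g v ≗₂ u → T (image g x u)
  image-intro {g} {x} {u} v v∈ xv gv≗u =
    any⁺ _ (lose v∈ (Equivalence.from T-∧ (xv , ==V2-complete (g v) u gv≗u)))

  image-elim : {g : V2 → V2} {x : Sub} {u : V2} → T (image g x u) → ∃ λ v → v ∈ allV2 × T (x v) × g v ≗₂ u
  image-elim {g} {x} {u} t with find (any⁻ _ allV2 t)
  ... | v , v∈ , xv∧gv≡u with Equivalence.to T-∧ xv∧gv≡u
  ... | xv , gv≡u = v , v∈ , xv , ==V2-sound (g v) u gv≡u

  image-∘ : {h g m : V2 → V2} → Resp h → (∀ v → h (g v) ≗₂ m v) →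
            (x : Sub) → ∀ u → image h (image g x) u ≡ image m x u
  image-∘ {h} {g} {m} h-resp hg≗m x u = T-injective to from
    where
    to : T (image h (image g x) u) → T (image m x u)
    to t with image-elim {h} t
    ... | w , _ , gxw , hw≗u with image-elim {g} gxw
    ... | v , v∈ , xv , gv≗w = image-intro {m} v v∈ xv (≗₂-trans (≗₂-sym (hg≗m v)) (≗₂-trans (h-resp gv≗w) hw≗u))
    from : T (image m x u) → T (image h (image g x) u)
    from t with image-elim {m} t
    ... | v , v∈ , xv , mv≗u =
      image-intro {h} (canonical₂ (g v)) (canonical₂-∈ (g v))
        (image-intro {g} v v∈ xv (≗₂-sym (canonical₂-≗ (g v))))
        (≗₂-trans (h-resp (canonical₂-≗ (g v))) (≗₂-trans (hg≗m v) mv≗u))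

  image-identity : {m : V2 → V2} → (∀ v → m v ≗₂ v) → (y : Sub) → image m y ≈ˢ y
  image-identity {m} m≗id y {u} u∈ = T-injective to from
    where
    to : T (image m y u) → T (y u)
    to t with image-elim {m} t
    ... | v , v∈ , yv , mv≗u = subst (T ∘ y) (∈-allV2-unique v∈ u∈ (≗₂-trans (≗₂-sym (m≗id v)) mv≗u)) yv
    from : T (y u) → T (image m y u)
    from yu = image-intro {m} u u∈ yu (m≗id u)

  image-cong : (g : V2 → V2) {x x' : Sub} → x ≈ˢ x' → ∀ u → image g x u ≡ image g x' u
  image-cong g {x} {x'} x≈x' u = T-injective (transport x≈x') (transport (≈ˢ-sym x≈x'))
    where
    transport : {x x' : Sub} → x ≈ˢ x' → T (image g x u) → T (image g x' u)
    transport x≈x' t with image-elim {g} t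
    ... | v , v∈ , xv , gv≗u = image-intro {g} v v∈ (subst T (x≈x' v∈) xv) gv≗u

  image-cancel : {g g' : V2 → V2} → Resp g → (∀ u → g (g' u) ≗₂ u) → (y : Sub) → image g (image g' y) ≈ˢ y
  image-cancel g-resp gg'≗id y =
    ≈ˢ-trans (λ {u} _ → image-∘ g-resp gg'≗id y u) (image-identity (λ _ → ≗₂-refl) y)

  sameSub-respˡ : {x x' : Sub} (y : Sub) → x ≈ˢ x' → sameSub x y ≡ sameSub x' y
  sameSub-respˡ {x} {x'} y x≈x' = T-injective
    (λ t → sameSub-complete {x'} (≈ˢ-trans (≈ˢ-sym x≈x') (sameSub-sound {x} t)))
    (λ t → sameSub-complete {x} (≈ˢ-trans x≈x' (sameSub-sound {x'} t)))

  sameSub-image : {g g' : V2 → V2} → Resp g → Resp g' → (∀ u → g (g' u) ≗₂ u) → (∀ u → g' (g u) ≗₂ u) →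
                  (x y : Sub) → sameSub (image g x) y ≡ sameSub x (image g' y)
  sameSub-image {g} {g'} g-resp g'-resp gg'≗id g'g≗id x y = T-injective
    (λ t → sameSub-complete {x} (≈ˢ-trans (≈ˢ-sym (image-cancel g'-resp g'g≗id x))
                                          (λ {u} _ → image-cong g' (sameSub-sound {image g x} t) u)))
    (λ t → sameSub-complete {image g x} (≈ˢ-trans (λ {u} _ → image-cong g (sameSub-sound {x} t) u)
                                                  (image-cancel g-resp gg'≗id y)))

module Kets (q : ℕ) .{{_ : NonZero q}} (D : ℕ) {c ℓ} (K : CommutativeRing c ℓ)
            (ζ : CommutativeRing.Carrier K) (ν : ℕ → CommutativeRing.Carrier K) where
  open PrimeField q
  open Dim D
  open Ket K ζ ν
  open CommutativeRing K using (Carrier; _+_; 0#)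
  open GeneralLinear q D
  open Subsets q D

  _≈ᵗ_ : Carrier × Sub → Carrier × Sub → Set c
  (k , x) ≈ᵗ (k' , x') = k ≡ k' × x ≈ˢ x'

  infix 4 _≋_
  _≋_ : 𝕍 → 𝕍 → Set c
  _≋_ = Pointwise _≈ᵗ_

  coeff-≋ : {v w : 𝕍} → v ≋ w → ∀ y → coeff v y ≡ coeff w y
  coeff-≋ [] y = refl
  coeff-≋ {(k , x) ∷ _} ((refl , x≈x') ∷ v≋w) y =
    cong₂ (λ b t → (if b then k else 0#) + t) (sameSub-respˡ y x≈x') (coeff-≋ v≋w y)

  scale-≋ : (k : Carrier) {v w : 𝕍} → v ≋ w → scale k v ≋ scale k w
  scale-≋ k []                    = []
  scale-≋ k ((refl , x≈x') ∷ v≋w) = (refl , x≈x') ∷ scale-≋ k v≋w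

  concatMap-≋ : ∀ {a} {A : Set a} {F G : A → 𝕍} → (∀ x → F x ≋ G x) → ∀ xs → concatMap F xs ≋ concatMap G xs
  concatMap-≋ F≋G []       = []
  concatMap-≋ F≋G (x ∷ xs) = ++⁺ (F≋G x) (concatMap-≋ F≋G xs)

  ρ-scale : (g : V2 → V2) (k : Carrier) (v : 𝕍) → ρ g (scale k v) ≡ scale k (ρ g v)
  ρ-scale g k []      = refl
  ρ-scale g k (p ∷ v) = cong (_ ∷_) (ρ-scale g k v)

  ρ-scale-≋ : (g : V2 → V2) (k : Carrier) {v w : 𝕍} → ρ g v ≋ w → ρ g (scale k v) ≋ scale k w
  ρ-scale-≋ g k {v} ρv≋w = subst (_≋ _) (sym (ρ-scale g k v)) (scale-≋ k ρv≋w)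

  ρ-concatMap : ∀ {a} {A : Set a} (g : V2 → V2) {F G : A → 𝕍} → (∀ x → ρ g (F x) ≋ G x) →
                ∀ xs → ρ g (concatMap F xs) ≋ concatMap G xs
  ρ-concatMap g {F} F≋G xs = subst (_≋ _) (sym (map-concatMap _ F xs)) (concatMap-≋ F≋G xs)

  ρ-∘ : {h g m : V2 → V2} → Resp h → (∀ v → h (g v) ≗₂ m v) → ∀ v → ρ h (ρ g v) ≋ ρ m v
  ρ-∘ h-resp hg≗m []            = []
  ρ-∘ h-resp hg≗m ((k , x) ∷ v) = (refl , λ {u} _ → image-∘ h-resp hg≗m x u) ∷ ρ-∘ h-resp hg≗m v

  coeff-ρ : {g g' : V2 → V2} → Resp g → Resp g' → (∀ u → g (g' u) ≗₂ u) → (∀ u → g' (g u) ≗₂ u) →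
            ∀ v y → coeff (ρ g v) y ≡ coeff v (image g' y)
  coeff-ρ g-resp g'-resp gg'≗id g'g≗id []            y = refl
  coeff-ρ g-resp g'-resp gg'≗id g'g≗id ((k , x) ∷ v) y =
    cong₂ (λ b t → (if b then k else 0#) + t) (sameSub-image g-resp g'-resp gg'≗id g'g≗id x y)
          (coeff-ρ g-resp g'-resp gg'≗id g'g≗id v y)

  ρ-toSp-cong : (h : GL) (v w : 𝕍) → v ≈V w → ρ (toSp h) v ≈V ρ (toSp h) w
  ρ-toSp-cong h v w v≈w y = begin
    coeff (ρ (toSp h) v) y            ≡⟨ coeff-ρ′ v ⟩
    coeff v (image (toSp (h ⁻¹ᴳ)) y)  ≈⟨ v≈w _ ⟩
    coeff w (image (toSp (h ⁻¹ᴳ)) y)  ≡⟨ coeff-ρ′ w ⟨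
    coeff (ρ (toSp h) w) y            ∎
    where
    open SetoidReasoning (CommutativeRing.setoid K)
    coeff-ρ′ : ∀ v → coeff (ρ (toSp h) v) y ≡ coeff v (image (toSp (h ⁻¹ᴳ)) y)
    coeff-ρ′ v = coeff-ρ (toSp-resp h) (toSp-resp (h ⁻¹ᴳ)) (toSp-inverse h) (toSp-inverse (h ⁻¹ᴳ)) v y

module Generators (q : ℕ) .{{_ : NonZero q}} (D : ℕ) {c ℓ} (K : CommutativeRing c ℓ)
                  (ζ : CommutativeRing.Carrier K) (ν : ℕ → CommutativeRing.Carrier K) where
  open PrimeField q
  open Dim D
  open Ket K ζ ν
  open CommutativeRing K using (Carrier) renaming (refl to ≈-refl)
  open Matrices q
  open GeneralLinear q D
  open Kets q D K ζ ν

  InSym-resp : ∀ {i} {M M' : Mat} → M ≐ M' → InSym i M → InSym i M'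
  InSym-resp M≐M' (M-sym , M-zero) =
    (λ m n → trans (sym (M≐M' m n)) (trans (M-sym m n) (M≐M' n m))) ,
    (λ m n outside → trans (sym (M≐M' m n)) (M-zero m n outside))

  ketI-cong : (i : ℕ) {M M' : Mat} → M ≐ M' → ketI i M ≡ ketI i M'
  ketI-cong i M≐M' = cong (scale (ν i)) (map-cong
    (λ F → cong (λ t → ζ ^K toℕ t , image (act I I F) (xsub i)) (sumF-cong (λ k → *ᴹ-congʳ M≐M' F k k)))
    (SymList i))

  ρ-genVec : (h : GL) {S S' : Mat} (γ : Gen S) (γ' : Gen S') → Gen.i γ ≡ Gen.i γ' →
             congr (GL.C (Gen.g γ)) S ≐ congr (GL.C (Gen.g γ')) S' →
             (∀ u → toSp h (toSp (Gen.g γ) u) ≗₂ toSp (Gen.g γ') u) →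
             ρ (toSp h) (genVec S γ) ≋ genVec S' γ'
  ρ-genVec h {S} γ γ' refl M≐M' hγ≗γ' =
    subst (λ v → ρ (toSp h) (genVec S γ) ≋ ρ (toSp (Gen.g γ')) v) (ketI-cong (Gen.i γ) M≐M')
          (ρ-∘ (toSp-resp h) hγ≗γ' _)

  summand : (S : Mat) → Carrier × Gen S → 𝕍
  summand S p = scale (proj₁ p) (genVec S (proj₂ p))

  module _ (h : GL) (S : Mat) where

    S' : Mat
    S' = congr (GL.Cinv h) S

    congr-translate : (C : Mat) → congr (GL.C h *ᴹ C) S' ≐ congr C S
    congr-translate C = begin
      congr (GL.C h *ᴹ C) S'        ≈⟨ congr-*ᴹ (GL.C h) C S' ⟩
      congr C (congr (GL.C h) S')   ≈⟨ congr-congʳ C (congr-cancel {GL.C h} {GL.Cinv h} (GL.invˡ h) S) ⟩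
      congr C S                     ∎
      where open ≐-Reasoning

    translate : Gen S → Gen S'
    translate γ = record
      { i    = Gen.i γ
      ; i≤D  = Gen.i≤D γ
      ; g    = h ·ᴳ Gen.g γ
      ; cond = InSym-resp {Gen.i γ} (≐-sym (congr-translate (GL.C (Gen.g γ)))) (Gen.cond γ)
      }

    untranslate : Gen S' → Gen S
    untranslate γ' = record
      { i    = Gen.i γ'
      ; i≤D  = Gen.i≤D γ'
      ; g    = h ⁻¹ᴳ ·ᴳ Gen.g γ'
      ; cond = InSym-resp {Gen.i γ'} (≐-sym (congr-*ᴹ (GL.Cinv h) (GL.C (Gen.g γ')) S)) (Gen.cond γ')
      }

    ρ-translate : (γ : Gen S) → ρ (toSp h) (genVec S γ) ≋ genVec S' (translate γ)
    ρ-translate γ = ρ-genVec h γ (translate γ) refl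
      (≐-sym (congr-translate (GL.C (Gen.g γ)))) (toSp-·ᴳ h (Gen.g γ))

    ρ-untranslate : (γ' : Gen S') → ρ (toSp h) (genVec S (untranslate γ')) ≋ genVec S' γ'
    ρ-untranslate γ' = ρ-genVec h (untranslate γ') γ' refl
      (congr-*ᴹ (GL.Cinv h) (GL.C (Gen.g γ')) S) (toSp-cancelˡ h (Gen.g γ'))

    ρ-span-translate : (cs : List (Carrier × Gen S)) →
                       ρ (toSp h) (concatMap (summand S) cs) ≋ concatMap (summand S') (map (map₂ translate) cs)
    ρ-span-translate cs =
      subst (ρ (toSp h) (concatMap (summand S) cs) ≋_) (sym (concatMap-map (summand S') (map₂ translate) cs))
            (ρ-concatMap (toSp h) (λ (k , γ) → ρ-scale-≋ (toSp h) k (ρ-translate γ)) cs)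

    ρ-span-untranslate : (cs : List (Carrier × Gen S')) →
                         ρ (toSp h) (concatMap (summand S) (map (map₂ untranslate) cs)) ≋ concatMap (summand S') cs
    ρ-span-untranslate cs =
      subst (λ v → ρ (toSp h) v ≋ concatMap (summand S') cs) (sym (concatMap-map (summand S) (map₂ untranslate) cs))
            (ρ-concatMap (toSp h) (λ (k , γ') → ρ-scale-≋ (toSp h) k (ρ-untranslate γ')) cs)

    ρW⊆W : ∀ v → InρW h S v → InW S' v
    ρW⊆W v (w , (cs , w≈span) , v≈ρw) = map (map₂ translate) cs , λ y → begin
      coeff v y                                                   ≈⟨ v≈ρw y ⟩
      coeff (ρ (toSp h) w) y                                      ≈⟨ ρ-toSp-cong h w (concatMap (summand S) cs) w≈span y ⟩
      coeff (ρ (toSp h) (concatMap (summand S) cs)) y             ≡⟨ coeff-≋ (ρ-span-translate cs) y ⟩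
      coeff (concatMap (summand S') (map (map₂ translate) cs)) y  ∎
      where open SetoidReasoning (CommutativeRing.setoid K)

    W⊆ρW : ∀ v → InW S' v → InρW h S v
    W⊆ρW v (cs , v≈span) = concatMap (summand S) cs' , (cs' , λ _ → ≈-refl) , λ y → begin
      coeff v y                                         ≈⟨ v≈span y ⟩
      coeff (concatMap (summand S') cs) y               ≡⟨ coeff-≋ (ρ-span-untranslate cs) y ⟨
      coeff (ρ (toSp h) (concatMap (summand S) cs')) y  ∎
      where
      open SetoidReasoning (CommutativeRing.setoid K)
      cs' = map (map₂ untranslate) cs

lemma3 : (q : ℕ) {{nz : NonZero q}} → Prime q → (D : ℕ) → 1 ≤ D →
  {c ℓ : Level} (K : CommutativeRing c ℓ) → IsField K →
  (ζ : CommutativeRing.Carrier K) (ν : ℕ → CommutativeRing.Carrier K) →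
  let open CommutativeRing K
      open PrimeField q
      open Dim D
      open Ket K ζ ν
  in (ζ ^K q ≈ 1#) → ¬ (ζ ≈ 1#) →
     (∀ i → ((ν i ^K 4) * (ℕ→K q ^K (i *ℕ suc i))) ≈ 1#) →
     (S : Mat) → IsSym S → (h : GL) →
     ∀ (v : 𝕍) →
       (InρW h S v → InW ((GL.Cinv h ᵗ) · (S · GL.Cinv h)) v) ×
       (InW ((GL.Cinv h ᵗ) · (S · GL.Cinv h)) v → InρW h S v)
lemma3 q _ D _ K _ ζ ν _ _ _ S _ h v = ρW⊆W h S v , W⊆ρW h S v
  where open Generators q D K ζ ν
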